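{- Let $f$ be a Boolean function in variables $V$ and let $\Pi$ be a partition of $V$. If $f$ is computed by a rectangle decision list of length $s$ in which all rectangles have partition $\Pi$, then there is an AND-protocol for $f$ with partition $\Pi$ of length at most $s$.
   Context: For a partition $\Pi=(X_1,X_2)$ of $V$, a rectangle with partition $\Pi$ is a function $R(V)=R_1(X_1)\land R_2(X_2)$. A rectangle decision list of length $s$ is a sequence $(R_1,c_1),\dots,(R_s,c_s)$ of rectangles $R_i$ and bits $c_i$, with $R_s$ the constant $1$; it computes $f(\tau)=c_i$ for the least $i$ with $R_i(\tau)=1$. An AND-protocol for $f$ with partition $(X,Y)$: two players receive assignments to $X$ and to $Y$ respectively; in each round each deterministically computes one bit (from its input and the history) and sends it to a third party, who announces the conjunction of the two bits; when the conjunction is $1$ the protocol ends and the players must output $f$ of the joint assignment. Its length is the maximum number of rounds over all inputs. -}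

module Defs where

open import Data.Nat using (ℕ; zero; suc)
open import Data.Bool using (Bool; true; false; _∧_; if_then_else_)
open import Data.Fin using (Fin)
open import Data.List using (List; []; _∷_; length)
open import Data.Maybe using (Maybe; just; nothing)
open import Data.Product using (Σ; _×_; _,_; proj₁; proj₂)
open import Relation.Binary.PropositionalEquality using (_≡_)

Assignment : ℕ → Set
Assignment n = Fin n → Bool

BoolFun : ℕ → Set
BoolFun n = Assignment n → Bool

-- A partition Π = (X₁ , X₂) of V is given by a side function:
-- X₁ = { i | side i ≡ false },  X₂ = { i | side i ≡ true }.
Partition : ℕ → Set
Partition n = Fin n → Bool

Block : ∀ {n} → Partition n → Bool → Set
Block {n} Π b = Σ (Fin n) (λ i → Π i ≡ b)

BlockAssignment : ∀ {n} → Partition n → Bool → Set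
BlockAssignment Π b = Block Π b → Bool

restrict : ∀ {n} (Π : Partition n) (b : Bool) → Assignment n → BlockAssignment Π b
restrict Π b τ (i , _) = τ i

record Rectangle {n} (Π : Partition n) : Set where
  field
    R₁ : BlockAssignment Π false → Bool
    R₂ : BlockAssignment Π true  → Bool

evalRect : ∀ {n} {Π : Partition n} → Rectangle Π → Assignment n → Bool
evalRect {Π = Π} R τ =
  Rectangle.R₁ R (restrict Π false τ) ∧ Rectangle.R₂ R (restrict Π true τ)

-- A rectangle decision list (R₁,c₁),…,(R_s,c_s) with all rectangles of
-- partition Π: the entries before the last, and the last entry (R_s , c_s),
-- where R_s is the constant-1 function.
record RectDL {n} (Π : Partition n) : Set where
  field
    entries  : List (Rectangle Π × Bool)
    lastRect : Rectangle Π
    lastBit  : Bool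
    lastConst : ∀ τ → evalRect lastRect τ ≡ true

dlLength : ∀ {n} {Π : Partition n} → RectDL Π → ℕ
dlLength L = suc (length (RectDL.entries L))

evalEntries : ∀ {n} {Π : Partition n} → List (Rectangle Π × Bool) → Bool → Assignment n → Bool
evalEntries [] c τ = c
evalEntries ((R , c) ∷ rest) d τ = if evalRect R τ then c else evalEntries rest d τ

evalDL : ∀ {n} {Π : Partition n} → RectDL Π → Assignment n → Bool
evalDL L = evalEntries (RectDL.entries L) (RectDL.lastBit L)

-- The history is the list of bits announced so far by the third
-- party (most recent first).  In each round each player computes one bit from
-- its own input and the history; the announced bit is their conjunction; when
-- it is 1 the protocol stops and each player outputs a bit computed from its
-- input and the final history.
record ANDProtocol (X Y : Set) : Set where
  field
    msgA : X → List Bool → Bool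
    msgB : Y → List Bool → Bool
    outA : X → List Bool → Bool
    outB : Y → List Bool → Bool

runFrom : ∀ {X Y} → ANDProtocol X Y → X → Y → ℕ → List Bool → Maybe (List Bool)
runFrom P x y zero h = nothing
runFrom P x y (suc k) h with ANDProtocol.msgA P x h ∧ ANDProtocol.msgB P y h
... | true  = just (true ∷ h)
... | false = runFrom P x y k (false ∷ h)

run : ∀ {X Y} → ANDProtocol X Y → X → Y → ℕ → Maybe (List Bool)
run P x y k = runFrom P x y k []

ComputesWithin : ∀ {n} (Π : Partition n) →
  ANDProtocol (BlockAssignment Π false) (BlockAssignment Π true) →
  BoolFun n → ℕ → Set
ComputesWithin {n} Π P f s = ∀ (τ : Assignment n) →
  Σ (List Bool) λ t →
    (run P (restrict Π false τ) (restrict Π true τ) s ≡ just t)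
    × (ANDProtocol.outA P (restrict Π false τ) t ≡ f τ)
    × (ANDProtocol.outB P (restrict Π true τ) t ≡ f τ)

{-# OPTIONS --safe #-}
-- In round i both players evaluate their half of the i-th rectangle of the
-- decision list, so the entryAt-evalRect conjunction is exactly the value of that
-- rectangle.  The protocol therefore stops in the round of the first rectangle
-- that accepts the input — at the latest in round s, since R_s ≡ 1 — and the
-- round number, i.e. the length of the history, tells both players which
-- output bit c_i to announce.
module Submission where

open import Defs
open import Data.Nat using (ℕ; zero; suc)
open import Data.Bool using (Bool; true; false; _∧_)
open import Data.List using (List; []; _∷_; length; drop)
open import Data.Maybe using (just)
open import Data.Product using (Σ; _×_; _,_; proj₁; proj₂)
open import Relation.Binary.PropositionalEquality using (_≡_; refl; trans; cong)

drop-suc-∷ : ∀ {A : Set} k (xs : List A) {y : A} {ys : List A} →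
  drop k xs ≡ y ∷ ys → drop (suc k) xs ≡ ys
drop-suc-∷ zero    (x ∷ xs) refl = refl
drop-suc-∷ (suc k) (x ∷ xs) eq   = drop-suc-∷ k xs eq

module _ {X Y : Set} (P : ANDProtocol X Y) (x : X) (y : Y) where
  open ANDProtocol P

  runFrom-accept : ∀ k h → msgA x h ∧ msgB y h ≡ true →
    runFrom P x y (suc k) h ≡ just (true ∷ h)
  runFrom-accept k h eq with msgA x h ∧ msgB y h
  runFrom-accept k h refl | true = refl

  runFrom-reject : ∀ k h → msgA x h ∧ msgB y h ≡ false →
    runFrom P x y (suc k) h ≡ runFrom P x y k (false ∷ h)
  runFrom-reject k h eq with msgA x h ∧ msgB y h
  runFrom-reject k h refl | false = refl

module DecisionListProtocol {n} {Π : Partition n} (L : RectDL Π) where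
  open RectDL L

  current : List (Rectangle Π × Bool) → Rectangle Π × Bool
  current []      = lastRect , lastBit
  current (e ∷ _) = e

  entryAt : List Bool → Rectangle Π × Bool
  entryAt h = current (drop (length h) entries)

  -- The output on the empty history is junk: the run never ends there.
  output : List Bool → Bool
  output []      = false
  output (_ ∷ h) = proj₂ (entryAt h)

  protocol : ANDProtocol (BlockAssignment Π false) (BlockAssignment Π true)
  protocol = record
    { msgA = λ x h → Rectangle.R₁ (proj₁ (entryAt h)) x
    ; msgB = λ y h → Rectangle.R₂ (proj₁ (entryAt h)) y
    ; outA = λ _ → output
    ; outB = λ _ → output
    }

  module _ (τ : Assignment n) where
    private
      x = restrict Π false τ
      y = restrict Π true τ

    entryAt-evalRect : ∀ h {rest} → drop (length h) entries ≡ rest →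
      evalRect (proj₁ (entryAt h)) τ ≡ evalRect (proj₁ (current rest)) τ
    entryAt-evalRect h eq = cong (λ es → evalRect (proj₁ (current es)) τ) eq

    runFrom-evalEntries : ∀ rest h → drop (length h) entries ≡ rest →
      Σ (List Bool) λ t →
        runFrom protocol x y (suc (length rest)) h ≡ just t
        × output t ≡ evalEntries rest lastBit τ
    runFrom-evalEntries [] h eq =
      true ∷ h , runFrom-accept protocol x y 0 h (trans (entryAt-evalRect h eq) (lastConst τ))
               , cong (λ es → proj₂ (current es)) eq
    runFrom-evalEntries ((R , c) ∷ rest) h eq with evalRect R τ in accepts
    ... | true =
      true ∷ h , runFrom-accept protocol x y _ h (trans (entryAt-evalRect h eq) accepts)
               , cong (λ es → proj₂ (current es)) eq
    ... | false =
      let t , ends , outputs = runFrom-evalEntries rest (false ∷ h) (drop-suc-∷ (length h) entries eq)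
      in t , trans (runFrom-reject protocol x y _ h (trans (entryAt-evalRect h eq) accepts)) ends , outputs

open DecisionListProtocol using (protocol; runFrom-evalEntries)

proposition5 : ∀ {n} (f : BoolFun n) (Π : Partition n) (L : RectDL Π) →
    (∀ τ → evalDL L τ ≡ f τ) →
    Σ (ANDProtocol (BlockAssignment Π false) (BlockAssignment Π true))
      (λ P → ComputesWithin Π P f (dlLength L))
proposition5 f Π L computes = protocol L , λ τ →
  let t , ends , outputs = runFrom-evalEntries L τ (RectDL.entries L) [] refl
  in t , ends , trans outputs (computes τ) , trans outputs (computes τ)
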